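{- If \(G\) is a finite simple graph with \(\Delta(G)\le 4\), then every necktie of \(G\) consists only of cliques of \(G\) that are triangles (i.e. have exactly three vertices).
   Context: A clique is a maximal complete subgraph; \(K(G)\) is the intersection graph of the cliques of \(G\), and \(K^{2}(G)=K(K(G))\). A vertex \(Q\) of \(K^{2}(G)\) (a clique of \(K(G)\), i.e. a maximal family of pairwise intersecting cliques of \(G\)) is a necktie of \(G\) if \(\bigcap Q=\emptyset\), i.e. no vertex of \(G\) lies in all members of \(Q\). -}

module Defs where

open import Data.Nat using (ℕ; _≤_)
open import Data.Fin using (Fin)
open import Data.Fin.Subset using (Subset; _∈_; _∉_; _⊆_; ∣_∣)
open import Data.Vec using (tabulate)
open import Data.Product using (Σ; _×_)
open import Relation.Nullary using (¬_; Dec; does)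
open import Relation.Binary.PropositionalEquality using (_≡_; _≢_)

record Graph (n : ℕ) : Set₁ where
  field
    Adj      : Fin n → Fin n → Set
    adj?     : ∀ u v → Dec (Adj u v)
    sym      : ∀ {u v} → Adj u v → Adj v u
    irrefl   : ∀ {u} → ¬ Adj u u
open Graph public

module _ {n : ℕ} (G : Graph n) where

  nbhd : Fin n → Subset n
  nbhd v = tabulate (λ u → does (adj? G v u))

  degree : Fin n → ℕ
  degree v = ∣ nbhd v ∣

  MaxDegree≤ : ℕ → Set
  MaxDegree≤ k = ∀ v → degree v ≤ k

  Complete : Subset n → Set
  Complete C = ∀ {u v} → u ∈ C → v ∈ C → u ≢ v → Adj G u v

  IsClique : Subset n → Set
  IsClique C = Complete C × (∀ D → C ⊆ D → Complete D → D ⊆ C)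

  Meets : Subset n → Subset n → Set
  Meets C D = Σ (Fin n) λ v → v ∈ C × v ∈ D

  -- A family of cliques of G (given as a predicate on vertex subsets) that is
  -- a clique of K(G): a maximal family of pairwise intersecting cliques of G.
  IsCliqueOfK : (Subset n → Set) → Set
  IsCliqueOfK Q =
    (∀ C → Q C → IsClique C)
    × (∀ C D → Q C → Q D → Meets C D)
    × (∀ C → IsClique C → Meets C C → (∀ D → Q D → Meets C D) → Q C)

  -- a necktie: a vertex Q of K²(G) with empty total intersection
  IsNecktie : (Subset n → Set) → Set
  IsNecktie Q = IsCliqueOfK Q × (¬ Σ (Fin n) λ v → ∀ C → Q C → v ∈ C)

-- Only two properties of a necktie matter: its members are pairwise intersecting
-- cliques, and no vertex lies in all of them.
-- A member C ⊆ {x, y} is impossible: some member D misses x and some member E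
-- misses y; E meets C, so x ∈ E, and then a vertex of D ∩ E is adjacent to both x
-- and y, hence lies in C by maximality, which it cannot.
-- A member C with |C| ≥ Δ(G) is impossible too, since then every vertex of C has at
-- most one neighbour outside C.  Choose a member D missing some x ∈ C; D ⊈ C (else
-- D = C), say z ∈ D ∖ C, and pick s ∈ C ∩ D.  A member B ⊆ C equals C, and any
-- other member B has z as its only vertex outside C, so it absorbs the neighbour s
-- of z by maximality.  Thus s would be common to all members.
module Submission where

open import Defs
open import Data.Nat using (ℕ; suc; _≤_; _<_; s≤s; z≤n)
open import Data.Nat.Properties using (≤-trans; ≤-<-trans; ≤-refl; ≤-antisym; ≤-pred; ≮⇒≥; <⇒≱; n≤1+n)
open import Data.Bool using (true; false)
open import Data.Fin using (Fin; zero; suc; _≟_)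
open import Data.Fin.Properties using (any?)
open import Data.Fin.Subset using (Subset; _∈_; _∉_; _⊆_; _∪_; _-_; ⁅_⁆; ∣_∣)
open import Data.Fin.Subset.Properties
  using (_∈?_; x∈p∪q⁺; x∈p∪q⁻; p⊆p∪q; x∈⁅x⁆; x∈⁅y⁆⇒x≡y; p⊆q⇒∣p∣≤∣q∣; ∪-identityʳ;
         x∈p∧x≢y⇒x∈p-y; x∈p⇒∣p-x∣<∣p∣)
open import Data.Vec using (_∷_)
open import Data.Vec.Properties using (lookup∘tabulate; lookup⇒[]=)
open import Data.Product using (Σ; ∃; _×_; _,_; proj₁; proj₂)
open import Function using (_∘′_)
open import Data.Sum using (_⊎_; inj₁; inj₂; map₂)
open import Data.Empty using (⊥; ⊥-elim)
open import Relation.Nullary using (¬_; yes; no; ¬?)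
open import Relation.Nullary.Decidable using (decidable-stable; dec-true; _×-dec_)
open import Relation.Binary.PropositionalEquality using (_≡_; _≢_; refl; trans; subst; ≢-sym)
  renaming (sym to ≡-sym)

private variable
  n : ℕ

∈∧∉⇒≢ : ∀ {p : Subset n} {x y} → x ∈ p → y ∉ p → x ≢ y
∈∧∉⇒≢ x∈p y∉p refl = y∉p x∈p

x∈p∪⁅y⁆⁻ : ∀ {p : Subset n} {x y} → x ∈ p ∪ ⁅ y ⁆ → x ∈ p ⊎ x ≡ y
x∈p∪⁅y⁆⁻ {p = p} {y = y} = map₂ (x∈⁅y⁆⇒x≡y y) ∘′ x∈p∪q⁻ p ⁅ y ⁆

∣p∪⁅x⁆∣≤1+∣p∣ : ∀ (p : Subset n) x → ∣ p ∪ ⁅ x ⁆ ∣ ≤ suc ∣ p ∣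
∣p∪⁅x⁆∣≤1+∣p∣ (false ∷ p) zero    rewrite ∪-identityʳ p = ≤-refl
∣p∪⁅x⁆∣≤1+∣p∣ (true  ∷ p) zero    rewrite ∪-identityʳ p = n≤1+n _
∣p∪⁅x⁆∣≤1+∣p∣ (false ∷ p) (suc x) = ∣p∪⁅x⁆∣≤1+∣p∣ p x
∣p∪⁅x⁆∣≤1+∣p∣ (true  ∷ p) (suc x) = s≤s (∣p∪⁅x⁆∣≤1+∣p∣ p x)

3≤∣p∣ : ∀ {p : Subset n} {x y z} → x ∈ p → y ∈ p → z ∈ p →
        x ≢ y → x ≢ z → y ≢ z → 3 ≤ ∣ p ∣
3≤∣p∣ x∈p y∈p z∈p x≢y x≢z y≢z =
  ≤-<-trans (≤-<-trans (≤-<-trans z≤n (x∈p⇒∣p-x∣<∣p∣ z∈p-x-y))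
                                      (x∈p⇒∣p-x∣<∣p∣ y∈p-x))
            (x∈p⇒∣p-x∣<∣p∣ x∈p)
  where
  y∈p-x = x∈p∧x≢y⇒x∈p-y y∈p (≢-sym x≢y)
  z∈p-x-y = x∈p∧x≢y⇒x∈p-y (x∈p∧x≢y⇒x∈p-y z∈p (≢-sym x≢z)) (≢-sym y≢z)

∣p∣≤2⇒z≡x⊎z≡y : ∀ {p : Subset n} {x y z} → ∣ p ∣ ≤ 2 →
                x ∈ p → y ∈ p → z ∈ p → x ≢ y → z ≡ x ⊎ z ≡ y
∣p∣≤2⇒z≡x⊎z≡y {x = x} {y} {z} ∣p∣≤2 x∈p y∈p z∈p x≢y with z ≟ x | z ≟ y
... | yes z≡x | _       = inj₁ z≡x
... | no _    | yes z≡y = inj₂ z≡y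
... | no z≢x  | no z≢y  =
  ⊥-elim (<⇒≱ (s≤s ∣p∣≤2) (3≤∣p∣ x∈p y∈p z∈p x≢y (≢-sym z≢x) (≢-sym z≢y)))

⊆⊎∃∉ : ∀ (p q : Subset n) → p ⊆ q ⊎ ∃ λ x → x ∈ p × x ∉ q
⊆⊎∃∉ p q with any? (λ x → (x ∈? p) ×-dec ¬? (x ∈? q))
... | yes witness = inj₂ witness
... | no ∄        = inj₁ λ {x} x∈p → decidable-stable (x ∈? q) (λ x∉q → ∄ (x , x∈p , x∉q))

module _ {n : ℕ} (G : Graph n) where

  adj⇒∈nbhd : ∀ {v u} → Adj G v u → u ∈ nbhd G v
  adj⇒∈nbhd {v} {u} v~u =
    lookup⇒[]= u _ (trans (lookup∘tabulate _ u) (dec-true (adj? G v u) v~u))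

  closedNbhd : Fin n → Subset n
  closedNbhd v = nbhd G v ∪ ⁅ v ⁆

  ∣closedNbhd∣≤1+degree : ∀ v → ∣ closedNbhd v ∣ ≤ suc (degree G v)
  ∣closedNbhd∣≤1+degree v = ∣p∪⁅x⁆∣≤1+∣p∣ (nbhd G v) v

  adj⇒∈closedNbhd : ∀ {v u} → Adj G v u → u ∈ closedNbhd v
  adj⇒∈closedNbhd v~u = p⊆p∪q _ (adj⇒∈nbhd v~u)

  complete⊆closedNbhd : ∀ {C x} → Complete G C → x ∈ C → C ⊆ closedNbhd x
  complete⊆closedNbhd {x = x} complete x∈C {u} u∈C with u ≟ x
  ... | yes refl = x∈p∪q⁺ (inj₂ (x∈⁅x⁆ u))
  ... | no u≢x   = adj⇒∈closedNbhd (complete x∈C u∈C (≢-sym u≢x))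

  ∣C∣<degree : ∀ {C x y z} → Complete G C → x ∈ C → y ∉ C → z ∉ C → y ≢ z →
               Adj G x y → Adj G x z → ∣ C ∣ < degree G x
  ∣C∣<degree {C} {x} {y} {z} complete x∈C y∉C z∉C y≢z x~y x~z =
    ≤-pred (≤-trans (≤-<-trans (≤-<-trans (p⊆q⇒∣p∣≤∣q∣ C⊆N-y-z) (x∈p⇒∣p-x∣<∣p∣ z∈N-y))
                                (x∈p⇒∣p-x∣<∣p∣ (adj⇒∈closedNbhd x~y)))
                    (∣closedNbhd∣≤1+degree x))
    where
    z∈N-y : z ∈ closedNbhd x - y
    z∈N-y = x∈p∧x≢y⇒x∈p-y (adj⇒∈closedNbhd x~z) (≢-sym y≢z)
    C⊆N-y-z : C ⊆ closedNbhd x - y - z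
    C⊆N-y-z u∈C = x∈p∧x≢y⇒x∈p-y (x∈p∧x≢y⇒x∈p-y (complete⊆closedNbhd complete x∈C u∈C)
                                                 (∈∧∉⇒≢ u∈C y∉C))
                                (∈∧∉⇒≢ u∈C z∉C)

  AtMostOneExternalNeighbour : Subset n → Set
  AtMostOneExternalNeighbour C =
    ∀ {x y z} → x ∈ C → y ∉ C → z ∉ C → Adj G x y → Adj G x z → y ≡ z

  atMostOneExternalNeighbour : ∀ {k C} → MaxDegree≤ G k → Complete G C → k ≤ ∣ C ∣ →
                               AtMostOneExternalNeighbour C
  atMostOneExternalNeighbour {C = C} Δ≤k complete k≤∣C∣ {x} {y} {z} x∈C y∉C z∉C x~y x~z
    with y ≟ z
  ... | yes y≡z = y≡z
  ... | no y≢z  = ⊥-elim (<⇒≱ (∣C∣<degree complete x∈C y∉C z∉C y≢z x~y x~z)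
                              (≤-trans (Δ≤k x) k≤∣C∣))

  clique-absorbs : ∀ {C u} → IsClique G C → (∀ {a} → a ∈ C → a ≢ u → Adj G u a) → u ∈ C
  clique-absorbs {C} {u} (complete , maximal) u~C =
    maximal (C ∪ ⁅ u ⁆) (p⊆p∪q _) complete∪u (x∈p∪q⁺ (inj₂ (x∈⁅x⁆ u)))
    where
    complete∪u : Complete G (C ∪ ⁅ u ⁆)
    complete∪u a∈ b∈ a≢b with x∈p∪⁅y⁆⁻ {p = C} a∈ | x∈p∪⁅y⁆⁻ {p = C} b∈
    ... | inj₁ a∈C  | inj₁ b∈C  = complete a∈C b∈C a≢b
    ... | inj₁ a∈C  | inj₂ refl = Graph.sym G (u~C a∈C a≢b)
    ... | inj₂ refl | inj₁ b∈C  = u~C b∈C (≢-sym a≢b)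
    ... | inj₂ refl | inj₂ refl = ⊥-elim (a≢b refl)

module NonHellyFamily {n : ℕ} (G : Graph n) {Q : Subset n → Set}
  (cliques : ∀ C → Q C → IsClique G C)
  (intersecting : ∀ C D → Q C → Q D → Meets G C D)
  (noCommonVertex : ¬ Σ (Fin n) λ v → ∀ C → Q C → v ∈ C)
  where

  complete : ∀ {C} → Q C → Complete G C
  complete {C} QC = proj₁ (cliques C QC)

  avoided : ∀ v → ¬ (∀ D → Q D → ¬ v ∉ D)
  avoided v v∈all = noCommonVertex (v , λ D QD → decidable-stable (v ∈? D) (v∈all D QD))

  private
    module SmallMember {C D E x y} (QC : Q C) (QD : Q D) (QE : Q E) (∣C∣≤2 : ∣ C ∣ ≤ 2)
                       (x∈C : x ∈ C) (x∉D : x ∉ D) (y∈C : y ∈ C) (y∈D : y ∈ D) (y∉E : y ∉ E)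
      where

      C⊆xy : ∀ {c} → c ∈ C → c ≡ x ⊎ c ≡ y
      C⊆xy c∈C = ∣p∣≤2⇒z≡x⊎z≡y ∣C∣≤2 x∈C y∈C c∈C (≢-sym (∈∧∉⇒≢ y∈D x∉D))

      x∈E : x ∈ E
      x∈E with intersecting C E QC QE
      ... | w , w∈C , w∈E with C⊆xy w∈C
      ... | inj₁ refl = w∈E
      ... | inj₂ refl = ⊥-elim (y∉E w∈E)

      ∈D∩E⇒∈C : ∀ {u} → u ∈ D → u ∈ E → u ∈ C
      ∈D∩E⇒∈C {u} u∈D u∈E = clique-absorbs G (cliques C QC) u~C
        where
        u~C : ∀ {a} → a ∈ C → a ≢ u → Adj G u a
        u~C a∈C a≢u with C⊆xy a∈C
        ... | inj₁ refl = complete QE u∈E x∈E (≢-sym a≢u)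
        ... | inj₂ refl = complete QD u∈D y∈D (≢-sym a≢u)

      absurd : ⊥
      absurd with intersecting D E QD QE
      ... | u , u∈D , u∈E with C⊆xy (∈D∩E⇒∈C u∈D u∈E)
      ... | inj₁ refl = x∉D u∈D
      ... | inj₂ refl = y∉E u∈E

  ¬∣member∣≤2 : ∀ {C} → Q C → ¬ ∣ C ∣ ≤ 2
  ¬∣member∣≤2 {C} QC ∣C∣≤2 with intersecting C C QC QC
  ... | x , x∈C , _ =
    avoided x λ D QD x∉D → let (y , y∈C , y∈D) = intersecting C D QC QD in
    avoided y λ E QE y∉E → SmallMember.absurd QC QD QE ∣C∣≤2 x∈C x∉D y∈C y∈D y∉E

  private
    module LargeMember {C} (QC : Q C) (unique : AtMostOneExternalNeighbour G C) where

      ⊆C⇒⊇C : ∀ {B} → Q B → B ⊆ C → C ⊆ B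
      ⊆C⇒⊇C {B} QB B⊆C = proj₂ (cliques B QB) C B⊆C (complete QC)

      external-unique : ∀ {B w z} → Q B → w ∈ B → w ∉ C → z ∈ B → z ∉ C → w ≡ z
      external-unique {B} QB w∈B w∉C z∈B z∉C with intersecting B C QB QC
      ... | t , t∈B , t∈C = unique t∈C w∉C z∉C (complete QB t∈B w∈B (∈∧∉⇒≢ t∈C w∉C))
                                                 (complete QB t∈B z∈B (∈∧∉⇒≢ t∈C z∉C))

      external-coincide : ∀ {B D z z′} → Q B → Q D →
                          z ∈ B → z ∉ C → z′ ∈ D → z′ ∉ C → z ≡ z′
      external-coincide {B} {D} QB QD z∈B z∉C z′∈D z′∉C with intersecting B D QB QD
      ... | w , w∈B , w∈D with w ∈? C
      ... | yes w∈C = unique w∈C z∉C z′∉C (complete QB w∈B z∈B (∈∧∉⇒≢ w∈C z∉C))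
                                           (complete QD w∈D z′∈D (∈∧∉⇒≢ w∈C z′∉C))
      ... | no w∉C  = trans (≡-sym (external-unique QB w∈B w∉C z∈B z∉C))
                            (external-unique QD w∈D w∉C z′∈D z′∉C)

      absorbs-neighbour-of-external : ∀ {B z s} → Q B → z ∈ B → z ∉ C → s ∈ C → Adj G s z → s ∈ B
      absorbs-neighbour-of-external {B} {z} {s} QB z∈B z∉C s∈C s~z =
        clique-absorbs G (cliques B QB) s~B
        where
        s~B : ∀ {a} → a ∈ B → a ≢ s → Adj G s a
        s~B {a} a∈B a≢s with a ∈? C
        ... | yes a∈C = complete QC s∈C a∈C (≢-sym a≢s)
        ... | no a∉C  = subst (Adj G s) (≡-sym (external-unique QB a∈B a∉C z∈B z∉C)) s~z

      common : ∀ {D z s} → Q D → z ∈ D → z ∉ C → s ∈ C → s ∈ D → ∀ B → Q B → s ∈ B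
      common {D} {z} {s} QD z∈D z∉C s∈C s∈D B QB with ⊆⊎∃∉ B C
      ... | inj₁ B⊆C = ⊆C⇒⊇C QB B⊆C s∈C
      ... | inj₂ (z′ , z′∈B , z′∉C) =
        absorbs-neighbour-of-external QB z′∈B z′∉C s∈C
          (subst (Adj G s) (external-coincide QD QB z∈D z∉C z′∈B z′∉C)
                 (complete QD s∈D z∈D (∈∧∉⇒≢ s∈C z∉C)))

      misses : ∀ {x} → x ∈ C → ∀ D → Q D → x ∉ D → ⊥
      misses x∈C D QD x∉D with ⊆⊎∃∉ D C
      ... | inj₁ D⊆C = x∉D (⊆C⇒⊇C QD D⊆C x∈C)
      ... | inj₂ (z , z∈D , z∉C) with intersecting C D QC QD
      ... | s , s∈C , s∈D = noCommonVertex (s , common QD z∈D z∉C s∈C s∈D)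

      absurd : ⊥
      absurd with intersecting C C QC QC
      ... | x , x∈C , _ = avoided x (misses x∈C)

  ¬atMostOneExternalNeighbour : ∀ {C} → Q C → ¬ AtMostOneExternalNeighbour G C
  ¬atMostOneExternalNeighbour QC unique = LargeMember.absurd QC unique

mainTheorem5 : (n : ℕ) (G : Graph n) → MaxDegree≤ G 4 →
    (Q : Subset n → Set) → IsNecktie G Q →
    ∀ C → Q C → ∣ C ∣ ≡ 3
mainTheorem5 n G Δ≤4 Q ((cliques , intersecting , _) , noCommonVertex) C QC =
  ≤-antisym (≮⇒≥ λ 3<∣C∣ → ¬atMostOneExternalNeighbour QC
                             (atMostOneExternalNeighbour G Δ≤4 (complete QC) 3<∣C∣))
            (≮⇒≥ λ ∣C∣<3 → ¬∣member∣≤2 QC (≤-pred ∣C∣<3))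
  where open NonHellyFamily G cliques intersecting noCommonVertex
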